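{- Let $T$ be a set of basic terms, $\kappa$ a time variable, and $\Delta$ the saturation of the sample set $\{t[\kappa]\mid t\in T\}$. Then for any homomorphism $h$ from the term algebra to $\mathbf{W}$ and any $n\in\omega^+$, there exists a $\Delta$-diagram $\delta$ such that $\delta(\kappa)=n$ and $\delta(t[\kappa])=h(t)(n)$ for all $t\in T$.
   Context: Let $\omega^+=\omega\cup\{\omega\}$ with its natural order; let $S(n)=n+1$ for $n\in\omega$ and $S(\omega)=\omega$. A time warp is a join-preserving map $\omega^+\to\omega^+$ (equivalently, order-preserving with $f(0)=0$ and $f(\omega)=\sup_{n\in\omega}f(n)$). With $p$ the predecessor time warp ($p(0)=0$, $p(\omega)=\omega$, $p(m)=m-1$ otherwise), $\mathbf{W}=\langle W,\wedge,\vee,\circ,{}',\mathrm{id}\rangle$ is the algebra of time warps with pointwise $\wedge,\vee$, composition, identity and $f'$ the largest time warp $g$ with $f\circ g\le p$. Terms use variables from a countably infinite set and the symbols $\wedge,\vee,\cdot,{}',1$; a term is basic if it uses only variables, $\cdot$, ${}'$, $1$. Samples: fix a countably infinite set of time variables $\kappa$ (disjoint from the term variables). Samples are generated by $\alpha::=\kappa\mid t[\alpha]\mid \mathrm{suc}(\alpha)\mid \mathrm{last}(t)$ with $t$ a basic term (purely syntactic). Let $\leadsto$ be the relation on samples given, for all basic $t,u$ and samples $\alpha$, by: $t[\alpha]\leadsto\alpha$; $(t\cdot u)[\alpha]\leadsto t[u[\alpha]]$; $\mathrm{suc}(\alpha)\leadsto\alpha$; $t'[\alpha]\leadsto t[t'[\alpha]]$;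 $t[\alpha]\leadsto t[\mathrm{last}(t)]$; $t'[\alpha]\leadsto t[\mathrm{suc}(t'[\alpha])]$. A sample set $\Delta$ is saturated if $\alpha\in\Delta$ and $\alpha\leadsto\beta$ imply $\beta\in\Delta$; the saturation of a sample set is the set of samples reachable from it by the reflexive transitive closure of $\leadsto$. For a saturated sample set $\Delta$, a $\Delta$-diagram is a map $\delta\colon\Delta\to\omega^+$ such that: (1) if $t[\alpha],t[\beta]\in\Delta$ and $\delta(\alpha)\le\delta(\beta)$ then $\delta(t[\alpha])\le\delta(t[\beta])$; (2) if $t[\alpha]\in\Delta$ and $\delta(\alpha)=0$ then $\delta(t[\alpha])=0$; (3) if $\mathrm{suc}(\alpha)\in\Delta$ then $\delta(\mathrm{suc}(\alpha))=S(\delta(\alpha))$; (4) if $t[\alpha]\in\Delta$ then $\delta(\mathrm{last}(t))\le\delta(\alpha)$ iff $\delta(t[\mathrm{last}(t)])=\delta(t[\alpha])$; (5) if $t[\mathrm{last}(t)]\in\Delta$ and $\delta(\mathrm{last}(t))=\omega$ then $\delta(t[\mathrm{last}(t)])=\omega$; (6) if $1[\alpha]\in\Delta$ then $\delta(1[\alpha])=\delta(\alpha)$; (7) if $\mathrm{last}(1)\in\Delta$ then $\delta(\mathrm{last}(1))=\omega$; (8) if $(t\cdot u)[\alpha]\in\Delta$ then $\delta((t\cdot u)[\alpha])=\delta(t[u[\alpha]])$; (9) if $\mathrm{last}(t\cdot u),\mathrm{last}(t),\mathrm{last}(u)\in\Delta$ and $\delta(\mathrm{last}(t\cdot u))=\omega$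 then $\delta(\mathrm{last}(t))=\delta(\mathrm{last}(u))=\omega$; (10) if $t'[\alpha]\in\Delta$ and $0<\delta(\alpha)<\omega$ then $\delta(t[t'[\alpha]])<\delta(\alpha)$; (11) if $t'[\alpha]\in\Delta$ and $\delta(t'[\alpha])<\omega$ then $\delta(\alpha)\le\delta(t[\mathrm{suc}(t'[\alpha])])$; (12) if $\mathrm{last}(t'),\mathrm{last}(t)\in\Delta$ and $\delta(\mathrm{last}(t'))=\omega$ then $\delta(\mathrm{last}(t))=\omega$. -}

module Defs where

open import Data.Nat using (ℕ; zero; suc; _⊓_; _⊔_) renaming (_≤_ to _≤ℕ_; _<_ to _<ℕ_)
open import Data.Product using (_×_)
open import Relation.Binary.PropositionalEquality using (_≡_)

data ω⁺ : Set where
  fin : ℕ → ω⁺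
  ω   : ω⁺

infix 4 _≤ω_ _<ω_

data _≤ω_ : ω⁺ → ω⁺ → Set where
  fin≤fin : ∀ {m n} → m ≤ℕ n → fin m ≤ω fin n
  ≤ω-top  : ∀ {x} → x ≤ω ω

data _<ω_ : ω⁺ → ω⁺ → Set where
  fin<fin : ∀ {m n} → m <ℕ n → fin m <ω fin n
  fin<ω   : ∀ {m} → fin m <ω ω

S : ω⁺ → ω⁺
S (fin n) = fin (suc n)
S ω       = ω

pred⁺ : ω⁺ → ω⁺
pred⁺ (fin zero)    = fin zero
pred⁺ (fin (suc m)) = fin m
pred⁺ ω             = ω

IsSup : (ℕ → ω⁺) → ω⁺ → Set
IsSup a x = (∀ n → a n ≤ω x) × (∀ y → (∀ n → a n ≤ω y) → x ≤ω y)

record TimeWarp : Set where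
  field
    fun     : ω⁺ → ω⁺
    mono    : ∀ {x y} → x ≤ω y → fun x ≤ω fun y
    fun-0   : fun (fin zero) ≡ fin zero
    fun-ω   : IsSup (λ n → fun (fin n)) (fun ω)
open TimeWarp public

_≈W_ : TimeWarp → TimeWarp → Set
f ≈W g = ∀ x → fun f x ≡ fun g x

_≤W_ : TimeWarp → TimeWarp → Set
f ≤W g = ∀ x → fun f x ≤ω fun g x

infixl 6 _∧ₜ_ _∨ₜ_
infixl 7 _·ₜ_

data Term : Set where
  var  : ℕ → Term
  _∧ₜ_ : Term → Term → Term
  _∨ₜ_ : Term → Term → Term
  _·ₜ_ : Term → Term → Term
  _′ₜ  : Term → Term
  1ₜ   : Term

data BTerm : Set where
  var  : ℕ → BTerm
  _·_  : BTerm → BTerm → BTerm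
  _′   : BTerm → BTerm
  1b   : BTerm

⌜_⌝ : BTerm → Term
⌜ var x ⌝ = var x
⌜ t · u ⌝ = ⌜ t ⌝ ·ₜ ⌜ u ⌝
⌜ t ′ ⌝   = ⌜ t ⌝ ′ₜ
⌜ 1b ⌝    = 1ₜ

-- Homomorphisms Term → W.
-- f' is the largest time warp g with f ∘ g ≤ p; "h(t') = h(t)'" is stated
-- literally as: h(t') is the largest time warp g with h(t) ∘ g ≤ p.

IsHom : (Term → TimeWarp) → Set
IsHom h =
    (∀ t u x → fun (h (t ∧ₜ u)) x ≡ meet (fun (h t) x) (fun (h u) x))
  × (∀ t u x → fun (h (t ∨ₜ u)) x ≡ join (fun (h t) x) (fun (h u) x))
  × (∀ t u x → fun (h (t ·ₜ u)) x ≡ fun (h t) (fun (h u) x))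
  × (∀ x → fun (h 1ₜ) x ≡ x)
  × (∀ t → (∀ x → fun (h t) (fun (h (t ′ₜ)) x) ≤ω pred⁺ x)
         × (∀ (g : TimeWarp) → (∀ x → fun (h t) (fun g x) ≤ω pred⁺ x)
                             → g ≤W h (t ′ₜ)))
  where
  meet : ω⁺ → ω⁺ → ω⁺
  meet (fin m) (fin n) = fin (m ⊓ n)
  meet (fin m) ω       = fin m
  meet ω y             = y
  join : ω⁺ → ω⁺ → ω⁺
  join (fin m) (fin n) = fin (m ⊔ n)
  join (fin m) ω       = ω
  join ω y             = ω

data Sample : Set where
  tv    : ℕ → Sample
  _[_]  : BTerm → Sample → Sample
  suc′  : Sample → Sample
  last  : BTerm → Sample

infix 4 _↝_
data _↝_ : Sample → Sample → Set where
  r1 : ∀ t α   → t [ α ] ↝ α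
  r2 : ∀ t u α → (t · u) [ α ] ↝ t [ u [ α ] ]
  r3 : ∀ α     → suc′ α ↝ α
  r4 : ∀ t α   → (t ′) [ α ] ↝ t [ (t ′) [ α ] ]
  r5 : ∀ t α   → t [ α ] ↝ t [ last t ]
  r6 : ∀ t α   → (t ′) [ α ] ↝ t [ suc′ ((t ′) [ α ]) ]

data Saturation (Γ : Sample → Set) : Sample → Set where
  base : ∀ {α} → Γ α → Saturation Γ α
  step : ∀ {α β} → Saturation Γ α → α ↝ β → Saturation Γ β

Initial : (BTerm → Set) → ℕ → Sample → Set
Initial T κ α = InitialD α
  where
  data InitialD : Sample → Set where
    mk : ∀ {t} → T t → InitialD (t [ tv κ ])

-- Δ-diagrams. A map Δ → ω⁺ is represented by a total function on samples
-- whose values outside Δ are irrelevant.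

IsDiagram : (Sample → Set) → (Sample → ω⁺) → Set
IsDiagram Δ δ =
    (∀ t α β → Δ (t [ α ]) → Δ (t [ β ]) → δ α ≤ω δ β → δ (t [ α ]) ≤ω δ (t [ β ]))
  × (∀ t α → Δ (t [ α ]) → δ α ≡ fin zero → δ (t [ α ]) ≡ fin zero)
  × (∀ α → Δ (suc′ α) → δ (suc′ α) ≡ S (δ α))
  × (∀ t α → Δ (t [ α ]) →
        (δ (last t) ≤ω δ α → δ (t [ last t ]) ≡ δ (t [ α ]))
      × (δ (t [ last t ]) ≡ δ (t [ α ]) → δ (last t) ≤ω δ α))
  × (∀ t → Δ (t [ last t ]) → δ (last t) ≡ ω → δ (t [ last t ]) ≡ ω)
  × (∀ α → Δ (1b [ α ]) → δ (1b [ α ]) ≡ δ α)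
  × (Δ (last 1b) → δ (last 1b) ≡ ω)
  × (∀ t u α → Δ ((t · u) [ α ]) → δ ((t · u) [ α ]) ≡ δ (t [ u [ α ] ]))
  × (∀ t u → Δ (last (t · u)) → Δ (last t) → Δ (last u) → δ (last (t · u)) ≡ ω
           → (δ (last t) ≡ ω) × (δ (last u) ≡ ω))
  × (∀ t α → Δ ((t ′) [ α ]) → fin zero <ω δ α → δ α <ω ω
           → δ (t [ (t ′) [ α ] ]) <ω δ α)
  × (∀ t α → Δ ((t ′) [ α ]) → δ ((t ′) [ α ]) <ω ω
           → δ α ≤ω δ (t [ suc′ ((t ′) [ α ]) ]))
  × (∀ t → Δ (last (t ′)) → Δ (last t) → δ (last (t ′)) ≡ ω → δ (last t) ≡ ω)

-- The diagram is the evaluation of samples in W at time n: δ(κ) = n, δ(t[α]) = h(t)(δ(α)),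
-- δ(suc(α)) = S(δ(α)), and δ(last(t)) is the least time at which h(t) reaches its final value
-- h(t)(ω).  That least time need not be computable from h(t) alone, but the residual
-- g = h(t') computes it: for 0 < y ≤ h(t)(ω), the first time h(t) reaches y is S(g(y)), since
-- g(y) is the largest time mapped strictly below y.  The clauses about last(t) then become
-- statements about warps that never attain their supremum at a finite time.
module Submission where

open import Defs
open import Data.Nat using (ℕ; zero; suc; z≤n; s≤s) renaming (_≤_ to _≤ℕ_)
import Data.Nat.Properties as ℕ
open import Data.Product using (Σ; _×_; _,_; proj₁; proj₂)
open import Data.Sum using (_⊎_; inj₁; inj₂)
open import Data.Empty using (⊥-elim)
open import Function using (_∘_)
open import Relation.Nullary using (¬_)
open import Relation.Binary.PropositionalEquality using (_≡_; _≢_; refl; sym; trans; cong; subst)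

≤ω-refl : ∀ {x} → x ≤ω x
≤ω-refl {fin n} = fin≤fin ℕ.≤-refl
≤ω-refl {ω}     = ≤ω-top

≤ω-trans : ∀ {x y z} → x ≤ω y → y ≤ω z → x ≤ω z
≤ω-trans (fin≤fin p) (fin≤fin q) = fin≤fin (ℕ.≤-trans p q)
≤ω-trans _           ≤ω-top      = ≤ω-top

≤ω-antisym : ∀ {x y} → x ≤ω y → y ≤ω x → x ≡ y
≤ω-antisym (fin≤fin p) (fin≤fin q) = cong fin (ℕ.≤-antisym p q)
≤ω-antisym ≤ω-top      ≤ω-top      = refl

≤ω-reflexive : ∀ {x y} → x ≡ y → x ≤ω y
≤ω-reflexive refl = ≤ω-refl

0≤ω : ∀ {x} → fin zero ≤ω x
0≤ω {fin n} = fin≤fin z≤n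
0≤ω {ω}     = ≤ω-top

ω≤⇒≡ω : ∀ {x} → ω ≤ω x → x ≡ ω
ω≤⇒≡ω ≤ω-top = refl

ω≰fin : ∀ {n} → ¬ (ω ≤ω fin n)
ω≰fin ()

fin-suc≰fin : ∀ {k} → ¬ (fin (suc k) ≤ω fin k)
fin-suc≰fin (fin≤fin p) = ℕ.<-irrefl refl p

<ω-irrefl : ∀ {x} → ¬ (x <ω x)
<ω-irrefl (fin<fin p) = ℕ.<-irrefl refl p

≤ω-<ω-connex : ∀ x y → x ≤ω y ⊎ y <ω x
≤ω-<ω-connex (fin m) (fin n) with ℕ.≤-<-connex m n
... | inj₁ m≤n = inj₁ (fin≤fin m≤n)
... | inj₂ n<m = inj₂ (fin<fin n<m)
≤ω-<ω-connex x       ω       = inj₁ ≤ω-top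
≤ω-<ω-connex ω       (fin n) = inj₂ fin<ω

≤∧≢⇒<ω : ∀ {x y} → x ≤ω y → x ≢ y → x <ω y
≤∧≢⇒<ω (fin≤fin p)       x≢y = fin<fin (ℕ.≤∧≢⇒< p (x≢y ∘ cong fin))
≤∧≢⇒<ω {fin m} ≤ω-top _   = fin<ω
≤∧≢⇒<ω {ω}     ≤ω-top x≢y = ⊥-elim (x≢y refl)

<ω-fin-suc⇒≤ω : ∀ {x m} → x <ω fin (suc m) → x ≤ω fin m
<ω-fin-suc⇒≤ω (fin<fin p) = fin≤fin (ℕ.<⇒≤pred p)

≤ω-fin⇒<ω-suc : ∀ {x m} → x ≤ω fin m → x <ω fin (suc m)
≤ω-fin⇒<ω-suc (fin≤fin p) = fin<fin (s≤s p)

<ω⇒S≤ω : ∀ {x y} → x <ω y → S x ≤ω y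
<ω⇒S≤ω (fin<fin p) = fin≤fin p
<ω⇒S≤ω fin<ω       = ≤ω-top

S-mono : ∀ {x y} → x ≤ω y → S x ≤ω S y
S-mono (fin≤fin p)       = fin≤fin (s≤s p)
S-mono {fin m} ≤ω-top = ≤ω-top
S-mono {ω}     ≤ω-top = ≤ω-top

not-finite⇒≡ω : ∀ x → (∀ m → x ≢ fin m) → x ≡ ω
not-finite⇒≡ω (fin m) x≢fin = ⊥-elim (x≢fin m refl)
not-finite⇒≡ω ω       _     = refl

fun-ω-< : ∀ (f : TimeWarp) {m} → (∀ n → fun f (fin n) <ω fin m) → fun f ω <ω fin m
fun-ω-< f {zero}  below with below 0
... | lt rewrite fun-0 f = ⊥-elim (<ω-irrefl lt)
fun-ω-< f {suc m} below =
  ≤ω-fin⇒<ω-suc (proj₂ (fun-ω f) (fin m) (<ω-fin-suc⇒≤ω ∘ below))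

Unattained : (ω⁺ → ω⁺) → Set
Unattained F = ∀ m → F (fin m) ≢ F ω

Unattained-cong : ∀ {F G : ω⁺ → ω⁺} → (∀ x → F x ≡ G x) → Unattained F → Unattained G
Unattained-cong F≗G unF m e = unF m (trans (F≗G (fin m)) (trans e (sym (F≗G ω))))

unattained⇒ω : ∀ (f : TimeWarp) → Unattained (fun f) → fun f ω ≡ ω
unattained⇒ω f un = not-finite⇒≡ω (fun f ω) λ c eq →
  <ω-irrefl (subst (_<ω fin c) eq (fun-ω-< f (below eq)))
  where
  below : ∀ {c} → fun f ω ≡ fin c → ∀ n → fun f (fin n) <ω fin c
  below eq n = ≤∧≢⇒<ω (subst (fun f (fin n) ≤ω_) eq (mono f ≤ω-top))
                      (λ e → un n (trans e (sym eq)))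

unattained-∘ʳ : ∀ {F G : ω⁺ → ω⁺} → Unattained (F ∘ G) → Unattained G
unattained-∘ʳ {F} unFG m e = unFG m (cong F e)

-- If f attained f(ω) at time m, then g would have to stay below m forever, so g(ω) would be finite.
unattained-∘ˡ : ∀ (f g : TimeWarp) → Unattained (fun g) → Unattained (fun f ∘ fun g)
              → Unattained (fun f)
unattained-∘ˡ f g unG unFG m fm≡fω = ω≮fin (subst (_<ω fin m) gω≡ω (fun-ω-< g below))
  where
  gω≡ω : fun g ω ≡ ω
  gω≡ω = unattained⇒ω g unG

  ω≮fin : ¬ (ω <ω fin m)
  ω≮fin ()

  below : ∀ n → fun g (fin n) <ω fin m
  below n with ≤ω-<ω-connex (fin m) (fun g (fin n))
  ... | inj₂ gn<m = gn<m
  ... | inj₁ m≤gn = ⊥-elim (unFG n (trans fgn≡fm (trans fm≡fω (cong (fun f) (sym gω≡ω)))))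
    where
    fgn≡fm : fun f (fun g (fin n)) ≡ fun f (fin m)
    fgn≡fm = ≤ω-antisym (≤ω-trans (mono f ≤ω-top) (≤ω-reflexive (sym fm≡fω))) (mono f m≤gn)

stepAt : ℕ → ω⁺ → ℕ → ω⁺
stepAt b       j zero    = fin zero
stepAt zero    j (suc y) = j
stepAt (suc b) j (suc y) = stepAt b j y

stepAt-≤ : ∀ b j y → stepAt b j y ≤ω j
stepAt-≤ b       j zero    = 0≤ω
stepAt-≤ zero    j (suc y) = ≤ω-refl
stepAt-≤ (suc b) j (suc y) = stepAt-≤ b j y

stepAt-mono : ∀ b j {y y′} → y ≤ℕ y′ → stepAt b j y ≤ω stepAt b j y′
stepAt-mono b       j {zero}  _       = 0≤ω
stepAt-mono zero    j {suc y} (s≤s _) = ≤ω-refl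
stepAt-mono (suc b) j {suc y} (s≤s p) = stepAt-mono b j p

stepAt-suc : ∀ b j → stepAt b j (suc b) ≡ j
stepAt-suc zero    j = refl
stepAt-suc (suc b) j = stepAt-suc b j

stepAt-cases : ∀ b j y → stepAt b j y ≡ fin zero ⊎ (stepAt b j y ≡ j × suc b ≤ℕ y)
stepAt-cases b       j zero    = inj₁ refl
stepAt-cases zero    j (suc y) = inj₂ (refl , s≤s z≤n)
stepAt-cases (suc b) j (suc y) with stepAt-cases b j y
... | inj₁ e        = inj₁ e
... | inj₂ (e , le) = inj₂ (e , s≤s le)

stepWarp : ℕ → ω⁺ → TimeWarp
stepWarp b j = record
  { fun   = F
  ; mono  = F-mono
  ; fun-0 = refl
  ; fun-ω = stepAt-≤ b j , λ y ub → subst (_≤ω y) (stepAt-suc b j) (ub (suc b))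
  }
  where
  F : ω⁺ → ω⁺
  F (fin y) = stepAt b j y
  F ω       = j

  F-mono : ∀ {x y} → x ≤ω y → F x ≤ω F y
  F-mono (fin≤fin p)       = stepAt-mono b j p
  F-mono {fin y} ≤ω-top = stepAt-≤ b j y
  F-mono {ω}     ≤ω-top = ≤ω-refl

IsResidual : TimeWarp → TimeWarp → Set
IsResidual f g = (∀ x → fun f (fun g x) ≤ω pred⁺ x)
               × (∀ (g₀ : TimeWarp) → (∀ x → fun f (fun g₀ x) ≤ω pred⁺ x) → g₀ ≤W g)

module Residual {f g : TimeWarp} (res : IsResidual f g) where

  f∘g≤pred : ∀ x → fun f (fun g x) ≤ω pred⁺ x
  f∘g≤pred = proj₁ res

  -- Maximality of g, tested against the step warp that jumps to j after time b.
  ≤-residual : ∀ {j b} → fun f j ≤ω fin b → j ≤ω fun g (fin (suc b))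
  ≤-residual {j} {b} fj≤b =
    subst (_≤ω fun g (fin (suc b))) (stepAt-suc b j)
          (proj₂ res (stepWarp b j) f∘step≤pred (fin (suc b)))
    where
    f∘step≤pred : ∀ x → fun f (fun (stepWarp b j) x) ≤ω pred⁺ x
    f∘step≤pred ω = ≤ω-top
    f∘step≤pred (fin y) with stepAt-cases b j y
    ... | inj₁ e = subst (λ z → fun f z ≤ω pred⁺ (fin y)) (sym e)
                         (subst (_≤ω pred⁺ (fin y)) (sym (fun-0 f)) 0≤ω)
    ... | inj₂ (e , s≤s b≤y′) = subst (λ z → fun f z ≤ω pred⁺ (fin y)) (sym e)
                                      (≤ω-trans fj≤b (fin≤fin b≤y′))

  ≤-f-suc-residual : ∀ {x k} → fun g x ≡ fin k → x ≤ω fun f (fin (suc k))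
  ≤-f-suc-residual {x} {k} gx≡k with fun f (fin (suc k)) in eq
  ... | ω     = ≤ω-top
  ... | fin c with ≤ω-<ω-connex x (fin c)
  ...   | inj₁ x≤c = x≤c
  ...   | inj₂ c<x = ⊥-elim (fin-suc≰fin (subst (fin (suc k) ≤ω_) gx≡k
            (≤ω-trans (≤-residual (≤ω-reflexive eq)) (mono g (<ω⇒S≤ω c<x)))))

  residual-ω-≤ : ∀ {w} → fun f (fin (suc w)) ≡ ω → fun g ω ≤ω fin w
  residual-ω-≤ {w} f1+w≡ω = proj₂ (fun-ω g) (fin w) bound
    where
    ω≰pred : ∀ a → ¬ (ω ≤ω pred⁺ (fin a))
    ω≰pred zero    ()
    ω≰pred (suc a) ()

    bound : ∀ a → fun g (fin a) ≤ω fin w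
    bound a with ≤ω-<ω-connex (fun g (fin a)) (fin w)
    ... | inj₁ ga≤w = ga≤w
    ... | inj₂ w<ga = ⊥-elim (ω≰pred a (subst (_≤ω pred⁺ (fin a)) f1+w≡ω
                        (≤ω-trans (mono f (<ω⇒S≤ω w<ga)) (f∘g≤pred (fin a)))))

  residual-<ω : ∀ {x} → fin zero <ω x → x <ω ω → fun f (fun g x) <ω x
  residual-<ω {fin (suc a)} _           _ = ≤ω-fin⇒<ω-suc (f∘g≤pred (fin (suc a)))
  residual-<ω {fin zero}    (fin<fin ()) _

  firstReach : ω⁺ → ω⁺
  firstReach (fin zero) = fin zero
  firstReach y          = S (fun g y)

  ≤-f-S-residual : ∀ {y} → fun g y <ω ω ⊎ y ≤ω fun f ω → y ≤ω fun f (S (fun g y))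
  ≤-f-S-residual {y} finite-or-≤fω with fun g y in eq | finite-or-≤fω
  ... | fin k | _        = ≤-f-suc-residual eq
  ... | ω     | inj₂ y≤fω = y≤fω

  firstReach-reaches : ∀ {y} → y ≤ω fun f ω → y ≤ω fun f (firstReach y)
  firstReach-reaches {fin zero}    _ = 0≤ω
  firstReach-reaches {fin (suc k)}   = ≤-f-S-residual ∘ inj₂
  firstReach-reaches {ω}             = ≤-f-S-residual ∘ inj₂

  firstReach-least : ∀ {y v} → y ≤ω fun f v → firstReach y ≤ω v
  firstReach-least {fin zero} _ = 0≤ω
  firstReach-least {fin (suc k)} {v} 1+k≤fv with ≤ω-<ω-connex v (fun g (fin (suc k)))
  ... | inj₂ g<v = <ω⇒S≤ω g<v
  ... | inj₁ v≤g = ⊥-elim (fin-suc≰fin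
          (≤ω-trans 1+k≤fv (≤ω-trans (mono f v≤g) (f∘g≤pred (fin (suc k))))))
  firstReach-least {ω} {ω} _ = ≤ω-top
  firstReach-least {ω} {fin zero} ω≤f0 = ⊥-elim (ω≰fin (subst (ω ≤ω_) (fun-0 f) ω≤f0))
  firstReach-least {ω} {fin (suc w)} ω≤f1+w = S-mono (residual-ω-≤ (ω≤⇒≡ω ω≤f1+w))

  lastPoint : ω⁺
  lastPoint = firstReach (fun f ω)

  f-lastPoint : fun f lastPoint ≡ fun f ω
  f-lastPoint = ≤ω-antisym (mono f ≤ω-top) (firstReach-reaches ≤ω-refl)

  lastPoint-least : ∀ {v} → fun f v ≡ fun f ω → lastPoint ≤ω v
  lastPoint-least fv≡fω = firstReach-least (≤ω-reflexive (sym fv≡fω))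

  lastPoint≤⇒f≡ : ∀ {v} → lastPoint ≤ω v → fun f lastPoint ≡ fun f v
  lastPoint≤⇒f≡ le = ≤ω-antisym (mono f le)
                       (≤ω-trans (mono f ≤ω-top) (≤ω-reflexive (sym f-lastPoint)))

  f≡⇒lastPoint≤ : ∀ {v} → fun f lastPoint ≡ fun f v → lastPoint ≤ω v
  f≡⇒lastPoint≤ e = lastPoint-least (trans (sym e) f-lastPoint)

  lastPoint≡ω⇒unattained : lastPoint ≡ ω → Unattained (fun f)
  lastPoint≡ω⇒unattained e m fm≡fω = ω≰fin (subst (_≤ω fin m) e (lastPoint-least fm≡fω))

  unattained⇒lastPoint≡ω : Unattained (fun f) → lastPoint ≡ ω
  unattained⇒lastPoint≡ω un = not-finite⇒≡ω lastPoint
    λ m e → un m (trans (cong (fun f) (sym e)) f-lastPoint)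

  lastPoint≡ω⇒f-ω : lastPoint ≡ ω → fun f ω ≡ ω
  lastPoint≡ω⇒f-ω = unattained⇒ω f ∘ lastPoint≡ω⇒unattained

  residual-unattained : Unattained (fun g) → Unattained (fun f)
  residual-unattained unG m fm≡fω = finite-time (unattained⇒ω g unG) m (trans fm≡fω fω≡ω)
    where
    fω≡ω : fun f ω ≡ ω
    fω≡ω with fun f ω in eq
    ... | ω     = refl
    ... | fin k = ⊥-elim (unG (suc k) (trans (ω≤⇒≡ω (≤-residual (≤ω-reflexive eq)))
                                            (sym (unattained⇒ω g unG))))

    finite-time : fun g ω ≡ ω → ∀ m → fun f (fin m) ≢ ω
    finite-time gω≡ω zero    f0≡ω = ω≰fin (subst (ω ≤ω_) (trans (sym f0≡ω) (fun-0 f)) ≤ω-refl)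
    finite-time gω≡ω (suc w) f1+w≡ω = ω≰fin (subst (_≤ω fin w) gω≡ω (residual-ω-≤ f1+w≡ω))

module Evaluation (h : Term → TimeWarp) (hom : IsHom h) where

  ⟦_⟧ : BTerm → ω⁺ → ω⁺
  ⟦ t ⟧ = fun (h ⌜ t ⌝)

  ⟦·⟧ : ∀ t u x → ⟦ t · u ⟧ x ≡ ⟦ t ⟧ (⟦ u ⟧ x)
  ⟦·⟧ t u = proj₁ (proj₂ (proj₂ hom)) ⌜ t ⌝ ⌜ u ⌝

  ⟦1⟧ : ∀ x → ⟦ 1b ⟧ x ≡ x
  ⟦1⟧ = proj₁ (proj₂ (proj₂ (proj₂ hom)))

  residual : ∀ t → IsResidual (h ⌜ t ⌝) (h ⌜ t ′ ⌝)
  residual t = proj₂ (proj₂ (proj₂ (proj₂ hom))) ⌜ t ⌝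

  module R (t : BTerm) = Residual {h ⌜ t ⌝} {h ⌜ t ′ ⌝} (residual t)

  lastPoint-1 : R.lastPoint 1b ≡ ω
  lastPoint-1 = R.unattained⇒lastPoint≡ω 1b λ m e → fin≢ω (trans (sym (⟦1⟧ (fin m)))
                                                             (trans e (⟦1⟧ ω)))
    where
    fin≢ω : ∀ {m} → fin m ≢ ω
    fin≢ω ()

  lastPoint-· : ∀ t u → R.lastPoint (t · u) ≡ ω → R.lastPoint t ≡ ω × R.lastPoint u ≡ ω
  lastPoint-· t u e = R.unattained⇒lastPoint≡ω t (unattained-∘ˡ (h ⌜ t ⌝) (h ⌜ u ⌝) unU unTU)
                    , R.unattained⇒lastPoint≡ω u unU
    where
    unTU : Unattained (⟦ t ⟧ ∘ ⟦ u ⟧)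
    unTU = Unattained-cong (⟦·⟧ t u) (R.lastPoint≡ω⇒unattained (t · u) e)

    unU : Unattained ⟦ u ⟧
    unU = unattained-∘ʳ {⟦ t ⟧} {⟦ u ⟧} unTU

  lastPoint-′ : ∀ t → R.lastPoint (t ′) ≡ ω → R.lastPoint t ≡ ω
  lastPoint-′ t e = R.unattained⇒lastPoint≡ω t
                      (R.residual-unattained t (R.lastPoint≡ω⇒unattained (t ′) e))

  evaluate : ω⁺ → Sample → ω⁺
  evaluate n (tv _)    = n
  evaluate n (t [ α ]) = ⟦ t ⟧ (evaluate n α)
  evaluate n (suc′ α)  = S (evaluate n α)
  evaluate n (last t)  = R.lastPoint t

  evaluate-diagram : ∀ n (Δ : Sample → Set) → IsDiagram Δ (evaluate n)
  evaluate-diagram n Δ =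
      (λ t _ _ _ _ → mono (h ⌜ t ⌝))
    , (λ t _ _ e → trans (cong ⟦ t ⟧ e) (fun-0 (h ⌜ t ⌝)))
    , (λ _ _ → refl)
    , (λ t _ _ → R.lastPoint≤⇒f≡ t , R.f≡⇒lastPoint≤ t)
    , (λ t _ e → trans (cong ⟦ t ⟧ e) (R.lastPoint≡ω⇒f-ω t e))
    , (λ α _ → ⟦1⟧ (evaluate n α))
    , (λ _ → lastPoint-1)
    , (λ t u α _ → ⟦·⟧ t u (evaluate n α))
    , (λ t u _ _ _ → lastPoint-· t u)
    , (λ t _ _ → R.residual-<ω t)
    , (λ t _ _ → R.≤-f-S-residual t ∘ inj₁)
    , (λ t _ _ → lastPoint-′ t)

proposition3p3 : (T : BTerm → Set) (κ : ℕ) (h : Term → TimeWarp) → IsHom h → (n : ω⁺)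
    → Σ (Sample → ω⁺) (λ δ → IsDiagram (Saturation (Initial T κ)) δ
        × (δ (tv κ) ≡ n)
        × (∀ t → T t → δ (t [ tv κ ]) ≡ fun (h ⌜ t ⌝) n))
proposition3p3 T κ h hom n =
  evaluate n , evaluate-diagram n (Saturation (Initial T κ)) , refl , λ _ _ → refl
  where open Evaluation h hom
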